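{- For each $v\in\{55,82,85,106,109,118\}$ there exists a super-simple $(v,4,2)$DD with $d\ge\frac12$.
   Context: A $(v,4,2)$DD is a pair $(X,\mathcal{B})$ with $|X|=v$ and $\mathcal{B}$ a collection of ordered $4$-tuples of distinct points (blocks) such that every ordered pair $(x,y)$ of distinct points appears in exactly $2$ blocks, where $(x,y)$ appears in $(a_1,\dots,a_4)$ if $x=a_i,y=a_j$ with $i<j$. It is super-simple if any two blocks, viewed as sets, share at most two points. A defining set is a subset of $\mathcal{B}$ contained in a unique $(v,4,2)$DD on $X$; $d$ is the size of a smallest defining set divided by $|\mathcal{B}|$. -}

module Defs where

open import Data.Nat using (ℕ; _≤_; _*_)
open import Data.Fin using (Fin)
open import Data.Fin.Properties using () renaming (_≟_ to _≟ᶠ_)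
open import Data.Vec using (Vec; _∷_; []; lookup; toList)
open import Data.Vec.Properties using (≡-dec)
open import Data.List using (List; length; filter; concatMap; _∷_; [])
import Data.List.Membership.DecPropositional as DecMem
open import Data.Product using (_×_; _,_; Σ-syntax)
open import Data.Product.Properties using () renaming (≡-dec to ×-dec)
open import Relation.Binary.PropositionalEquality using (_≡_; _≢_)
open import Relation.Binary.Definitions using (DecidableEquality)

Block : ℕ → Set
Block v = Vec (Fin v) 4

_≟ᵇ_ : ∀ {v} → DecidableEquality (Block v)
_≟ᵇ_ = ≡-dec _≟ᶠ_

DistinctBlock : ∀ {v} → Block v → Set
DistinctBlock b = ∀ i j → i ≢ j → lookup b i ≢ lookup b j

orderedPairs : ∀ {v} → Block v → List (Fin v × Fin v)
orderedPairs (a₁ ∷ a₂ ∷ a₃ ∷ a₄ ∷ []) =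
  (a₁ , a₂) ∷ (a₁ , a₃) ∷ (a₁ , a₄) ∷ (a₂ , a₃) ∷ (a₂ , a₄) ∷ (a₃ , a₄) ∷ []

-- number of blocks of B in which the ordered pair (x,y) appears
-- (for blocks with distinct entries, a pair occurs at most once in orderedPairs b)
pairCount : ∀ {v} → List (Block v) → Fin v → Fin v → ℕ
pairCount B x y =
  length (filter (λ p → ×-dec _≟ᶠ_ _≟ᶠ_ p (x , y)) (concatMap orderedPairs B))

IsDD : (v : ℕ) → List (Block v) → Set
IsDD v B =
  (∀ (b : Fin (length B)) → DistinctBlock (Data.List.lookup B b)) ×
  (∀ (x y : Fin v) → x ≢ y → pairCount B x y ≡ 2)

common : ∀ {v} → Block v → Block v → ℕ
common {v} b c = length (filter (λ a → a ∈? toList c) (toList b))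
  where open DecMem (_≟ᶠ_ {v})

SuperSimple : ∀ {v} → List (Block v) → Set
SuperSimple B = ∀ (i j : Fin (length B)) → i ≢ j →
  common (Data.List.lookup B i) (Data.List.lookup B j) ≤ 2

-- multiplicity of a block in a collection (collections of blocks are multisets)
mult : ∀ {v} → Block v → List (Block v) → ℕ
mult b B = length (filter (λ c → c ≟ᵇ b) B)

_⊆ₘ_ : ∀ {v} → List (Block v) → List (Block v) → Set
S ⊆ₘ B = ∀ b → mult b S ≤ mult b B

_≈ₘ_ : ∀ {v} → List (Block v) → List (Block v) → Set
B ≈ₘ B′ = ∀ b → mult b B ≡ mult b B′

IsDefiningSet : (v : ℕ) → List (Block v) → List (Block v) → Set
IsDefiningSet v B S =
  S ⊆ₘ B × (∀ (B′ : List (Block v)) → IsDD v B′ → S ⊆ₘ B′ → B′ ≈ₘ B)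

-- d ≥ 1/2: every defining set (hence a smallest one) has size ≥ |B|/2
DefiningRatioAtLeastHalf : (v : ℕ) → List (Block v) → Set
DefiningRatioAtLeastHalf v B =
  ∀ (S : List (Block v)) → IsDefiningSet v B S → length B ≤ 2 * length S

-- The designs are built from trades {(x,y,a,d), (y,x,e,f)}, developed modulo v.
-- Exchanging the first two points of both blocks of such a trade only moves the
-- ordered pairs (x,y) and (y,x) from one block to the other, so it turns the
-- design into another (v,4,2)DD, and super-simplicity makes the new design
-- different.  The blocks split into |B|/2 disjoint trades, hence a defining set
-- meets every trade and has at least |B|/2 blocks.  That the developed blocks
-- form a super-simple (v,4,2)DD is certified by computation: the sorted codes of
-- their ordered pairs are compared with the list every (v,4,2)DD must produce,
-- and the sums of 2^x over the 3-subsets of the blocks are checked to be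
-- pairwise distinct, so that no two blocks share three points.
module Submission where

open import Data.Bool using (false; true; if_then_else_; T)
open import Data.Fin using (Fin; zero; suc; toℕ)
open import Data.Fin.Properties using (suc-injective; toℕ-injective; toℕ<n; toℕ-fromℕ<)
  renaming (_≟_ to _≟ᶠ_)
open import Data.List
  using (List; []; _∷_; _++_; length; map; concatMap; filter; replicate; downFrom; upTo; take; lookup)
open import Data.List.Membership.Propositional using (_∈_; _∉_; find)
open import Data.List.Membership.Propositional.Properties
  using (∈-concatMap⁺; ∈-filter⁺; ∈-++⁺ˡ; ∈-++⁺ʳ; ∈-map⁺; ∈-∃++; ∈-lookup)
open import Data.List.Properties
  using (filter-++; length-++; filter-accept; filter-reject; filter-all; filter-none; length-take;
         concatMap-++; concatMap-map; concatMap-cong; map-++; ++-assoc)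
  renaming (≡-dec to List-≡-dec)
open import Data.List.Relation.Binary.Permutation.Propositional
  using (_↭_; prep; swap; ↭-refl; ↭-sym; ↭-trans; ↭⇒↭ₛ)
import Data.List.Relation.Binary.Permutation.Propositional.Properties as ↭
open import Data.List.Relation.Binary.Permutation.Setoid.Properties using (Unique-resp-↭)
open import Data.List.Relation.Binary.Subset.Propositional using (_⊆_)
open import Data.List.Relation.Binary.Subset.Propositional.Properties using (⊆-reflexive)
open import Data.List.Relation.Unary.All as All using (All; []; _∷_)
import Data.List.Relation.Unary.All.Properties as All
open import Data.List.Relation.Unary.AllPairs as AllPairs using (AllPairs; []; _∷_)
open import Data.List.Relation.Unary.Any as Any using (Any; here; there)
open import Data.List.Relation.Unary.Linked using (Linked; linked?)
open import Data.List.Relation.Unary.Linked.Properties using (Linked⇒AllPairs)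
open import Data.List.Relation.Unary.Unique.Propositional using (Unique)
import Data.List.Relation.Unary.Unique.Propositional.Properties as Unique
open import Data.Nat using (ℕ; zero; suc; _+_; _*_; _^_; _≤_; _<_; _>_; z≤n; s≤s; _≟_; _≤?_; _≡ᵇ_; NonZero)
open import Data.Nat.DivMod
  using (_/_; _%_; _mod_; m%n<n; [m+kn]%n≡m%n; m<n⇒m%n≡m; +-distrib-/; m*n%n≡0; m*n/n≡m; m<n⇒m/n≡0)
open import Data.Nat.ListAction using (sum)
open import Data.Nat.ListAction.Properties using (sum-↭)
open import Data.Nat.Properties
  using (≤-refl; ≤-reflexive; ≤-trans; ≤-pred; <⇒≤; <⇒≢; >⇒≢; ≤∧≢⇒<; ≰⇒>; <-irrefl; <-trans;
         ≤-<-trans; n≤1+n; n≢0⇒n>0; m≤n⇒m⊓n≡m; +-identityʳ; +-assoc; +-comm; *-suc; m+n≡0⇒m≡0; m+n≡0⇒n≡0;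
         +-monoˡ-≤; +-monoʳ-≤; +-mono-≤; +-monoʳ-<; *-monoˡ-≤; *-cancelˡ-<; ≡ᵇ⇒≡; _>?_;
         ≤-decTotalOrder; +-commutativeSemigroup; module ≤-Reasoning)
open import Data.Product using (_×_; _,_; proj₁; proj₂; ∃-syntax; Σ-syntax)
open import Data.Product.Properties using () renaming (≡-dec to ×-≡-dec)
open import Data.Unit using (tt)
open import Data.Vec as Vec using (Vec; _∷_; []; toList)
open import Data.Vec.Relation.Unary.All using ([]; _∷_)
import Data.Vec.Relation.Unary.All.Properties as VecAll
open import Data.Vec.Relation.Unary.AllPairs using ([]; _∷_)
open import Data.Vec.Relation.Unary.Unique.Propositional using () renaming (Unique to Uniqueᵛ)
open import Data.Vec.Relation.Unary.Unique.Propositional.Properties using (lookup-injective)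
open import Function using (_∘_)
open import Level using (0ℓ)
open import Relation.Binary.Construct.Flip.EqAndOrd as Flip using ()
open import Relation.Binary.Definitions using (DecidableEquality)
open import Relation.Binary.PropositionalEquality
  using (_≡_; _≢_; refl; sym; trans; cong; cong₂; subst; subst₂; setoid; ≢-sym; module ≡-Reasoning)
open import Relation.Nullary using (¬_; Dec; yes; no; contradiction; _×-dec_)
open import Relation.Nullary.Decidable using (True; toWitness)
open import Relation.Unary using (Pred; Decidable)

open import Algebra.Properties.CommutativeSemigroup +-commutativeSemigroup using (x∙yz≈y∙xz)
-- sort produces decreasing lists, the order of downFromWith below
open import Data.List.Sort.MergeSort.Base (Flip.decTotalOrder ≤-decTotalOrder) using (sort)
open import Data.List.Sort.MergeSort.Properties (Flip.decTotalOrder ≤-decTotalOrder) using (sort-↭)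

open import Defs

count : ∀ {A : Set} {P : Pred A 0ℓ} → Decidable P → List A → ℕ
count P? xs = length (filter P? xs)

module _ {A : Set} {P : Pred A 0ℓ} (P? : Decidable P) where

  count-++ : ∀ xs ys → count P? (xs ++ ys) ≡ count P? xs + count P? ys
  count-++ xs ys = trans (cong length (filter-++ P? xs ys)) (length-++ (filter P? xs))

  count-↭ : ∀ {xs ys} → xs ↭ ys → count P? xs ≡ count P? ys
  count-↭ p = ↭.↭-length (↭.filter-↭ P? p)

  count-accept : ∀ {x xs} → P x → count P? (x ∷ xs) ≡ suc (count P? xs)
  count-accept px = cong length (filter-accept P? px)

  count-reject : ∀ {x xs} → ¬ P x → count P? (x ∷ xs) ≡ count P? xs
  count-reject ¬px = cong length (filter-reject P? ¬px)

  count-∷-≤ : ∀ x xs → count P? xs ≤ count P? (x ∷ xs)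
  count-∷-≤ x xs with P? x
  ... | yes _ = n≤1+n _
  ... | no _  = ≤-refl

  count≡0⇒∉ : ∀ {xs x} → count P? xs ≡ 0 → x ∈ xs → ¬ P x
  count≡0⇒∉ {xs} none x∈xs px = ∉-length≡0 (filter P? xs) none (∈-filter⁺ P? x∈xs px)
    where
    ∉-length≡0 : ∀ ys {y} → length ys ≡ 0 → y ∉ ys
    ∉-length≡0 [] _ ()

count-map : ∀ {A : Set} (_≟A_ : DecidableEquality A) (f : A → ℕ) → (∀ {p q} → f p ≡ f q → p ≡ q) →
            ∀ a xs → count (_≟A a) xs ≡ count (_≟ f a) (map f xs)
count-map _≟A_ f f-inj a []       = refl
count-map _≟A_ f f-inj a (x ∷ xs) with x ≟A a
... | yes x≡a = trans (cong suc (count-map _≟A_ f f-inj a xs)) (sym (count-accept (_≟ f a) (cong f x≡a)))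
... | no x≢a  = trans (count-map _≟A_ f f-inj a xs) (sym (count-reject (_≟ f a) (x≢a ∘ f-inj)))

count-unique-≤1 : ∀ {A : Set} (_≟A_ : DecidableEquality A) {x : A} {xs} → Unique xs → count (x ≟A_) xs ≤ 1
count-unique-≤1 _≟A_             []           = z≤n
count-unique-≤1 _≟A_ {x} {y ∷ _} (y∉ys ∷ u) with x ≟A y
... | yes refl = s≤s (≤-reflexive (cong length (filter-none (x ≟A_) y∉ys)))
... | no _     = count-unique-≤1 _≟A_ u

count-replicate-self : ∀ k c → count (_≟ c) (replicate k c) ≡ k
count-replicate-self zero    c = refl
count-replicate-self (suc k) c = trans (count-accept (_≟ c) refl) (cong suc (count-replicate-self k c))

count-replicate-other : ∀ k {i c} → i ≢ c → count (_≟ c) (replicate k i) ≡ 0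
count-replicate-other zero    i≢c = refl
count-replicate-other (suc k) i≢c = trans (count-reject (_≟ _) i≢c) (count-replicate-other k i≢c)

module _ (m : ℕ → ℕ) where

  downFromWith : ℕ → List ℕ
  downFromWith n = concatMap (λ i → replicate (m i) i) (downFrom n)

  count-downFromWith-≥ : ∀ {n c} → n ≤ c → count (_≟ c) (downFromWith n) ≡ 0
  count-downFromWith-≥ {zero}  _   = refl
  count-downFromWith-≥ {suc n} {c} n<c =
    trans (count-++ (_≟ c) (replicate (m n) n) (downFromWith n))
          (cong₂ _+_ (count-replicate-other (m n) (<⇒≢ n<c)) (count-downFromWith-≥ (<⇒≤ n<c)))

  count-downFromWith : ∀ {n c} → c < n → count (_≟ c) (downFromWith n) ≡ m c
  count-downFromWith {suc n} {c} c<1+n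
    rewrite count-++ (_≟ c) (replicate (m n) n) (downFromWith n) with n ≟ c
  ... | yes refl = trans (cong₂ _+_ (count-replicate-self (m n) n) (count-downFromWith-≥ {n} ≤-refl))
                         (+-identityʳ (m n))
  ... | no n≢c   = cong₂ _+_ (count-replicate-other (m n) n≢c)
                             (count-downFromWith (≤∧≢⇒< (≤-pred c<1+n) (≢-sym n≢c)))

pigeonhole : ∀ {A : Set} (f : A → ℕ) xs → sum (map f xs) < length xs → Any (λ x → f x ≡ 0) xs
pigeonhole f (x ∷ xs) lt with f x ≟ 0
... | yes fx≡0 = here fx≡0
... | no fx≢0  = there (pigeonhole f xs (≤-trans (+-monoˡ-≤ _ (n≢0⇒n>0 fx≢0)) (≤-pred lt)))

∈-∷⁻ : ∀ {A : Set} {x y : A} {xs} → y ∈ x ∷ xs → y ≢ x → y ∈ xs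
∈-∷⁻ (here y≡x)   y≢x = contradiction y≡x y≢x
∈-∷⁻ (there y∈xs) _   = y∈xs

↭-exchange : ∀ {A : Set} (p q : A) xs ys → p ∷ xs ++ q ∷ ys ↭ q ∷ xs ++ p ∷ ys
↭-exchange p q xs ys =
  ↭-trans (prep p (↭.shift q xs ys)) (↭-trans (swap p q ↭-refl) (prep q (↭-sym (↭.shift p xs ys))))

flatten : ∀ {A : Set} → List (A × A) → List A
flatten []            = []
flatten ((a , b) ∷ P) = a ∷ b ∷ flatten P

module _ {A : Set} where

  flatten-++ : ∀ (P Q : List (A × A)) → flatten (P ++ Q) ≡ flatten P ++ flatten Q
  flatten-++ []            Q = refl
  flatten-++ ((a , b) ∷ P) Q = cong (λ xs → a ∷ b ∷ xs) (flatten-++ P Q)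

  length-flatten : ∀ (P : List (A × A)) → length (flatten P) ≡ 2 * length P
  length-flatten []            = refl
  length-flatten ((a , b) ∷ P) =
    trans (cong (2 +_) (length-flatten P)) (sym (*-suc 2 (length P)))

  flatten-map : ∀ {B : Set} (f : A → B) (P : List (A × A)) →
                flatten (map (λ (a , b) → f a , f b) P) ≡ map f (flatten P)
  flatten-map f []            = refl
  flatten-map f ((a , b) ∷ P) = cong (λ xs → f a ∷ f b ∷ xs) (flatten-map f P)

  All-lookup⁺ : ∀ {P : Pred A 0ℓ} {xs} → All P xs → ∀ i → P (lookup xs i)
  All-lookup⁺ pxs i = All.lookup pxs (∈-lookup i)

  All-lookup⁻ : ∀ {P : Pred A 0ℓ} {xs} → (∀ i → P (lookup xs i)) → All P xs
  All-lookup⁻ {xs = []}     _ = []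
  All-lookup⁻ {xs = x ∷ xs} p = p zero ∷ All-lookup⁻ (p ∘ suc)

  AllPairs-lookup⁻ : ∀ {R : A → A → Set} {xs} →
                     (∀ i j → i ≢ j → R (lookup xs i) (lookup xs j)) → AllPairs R xs
  AllPairs-lookup⁻ {xs = []}     _ = []
  AllPairs-lookup⁻ {xs = x ∷ xs} r =
    All-lookup⁻ (λ j → r zero (suc j) λ ()) ∷
    AllPairs-lookup⁻ (λ i j i≢j → r (suc i) (suc j) (i≢j ∘ suc-injective))

  unique-++-disjoint : ∀ {xs ys} {x : A} → Unique (xs ++ ys) → x ∈ xs → x ∉ ys
  unique-++-disjoint (x∉ ∷ _) (here refl)  x∈ys = All.lookup x∉ (∈-++⁺ʳ _ x∈ys) refl
  unique-++-disjoint (_ ∷ u)  (there x∈xs)      = unique-++-disjoint u x∈xs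

  unique-++⁻ʳ : ∀ xs {ys : List A} → Unique (xs ++ ys) → Unique ys
  unique-++⁻ʳ []       u       = u
  unique-++⁻ʳ (_ ∷ xs) (_ ∷ u) = unique-++⁻ʳ xs u

module _ {A B : Set} (f : A → List B) where

  ∈-concatMap-lookup : ∀ xs i {y} → y ∈ f (lookup xs i) → y ∈ concatMap f xs
  ∈-concatMap-lookup (x ∷ xs) zero    y∈ = ∈-++⁺ˡ y∈
  ∈-concatMap-lookup (x ∷ xs) (suc i) y∈ = ∈-++⁺ʳ (f x) (∈-concatMap-lookup xs i y∈)

  unique-concatMap-disjoint : ∀ xs {y} → Unique (concatMap f xs) → ∀ i j → i ≢ j →
                              y ∈ f (lookup xs i) → y ∉ f (lookup xs j)
  unique-concatMap-disjoint (x ∷ xs) u zero    zero    i≢j _   _   = i≢j refl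
  unique-concatMap-disjoint (x ∷ xs) u zero    (suc j) _   y∈i y∈j =
    unique-++-disjoint u y∈i (∈-concatMap-lookup xs j y∈j)
  unique-concatMap-disjoint (x ∷ xs) u (suc i) zero    _   y∈i y∈j =
    unique-++-disjoint u y∈j (∈-concatMap-lookup xs i y∈i)
  unique-concatMap-disjoint (x ∷ xs) u (suc i) (suc j) i≢j y∈i y∈j =
    unique-concatMap-disjoint xs (unique-++⁻ʳ (f x) u) i j (i≢j ∘ cong suc) y∈i y∈j

module _ {A : Set} where

  uniqueᵛ⇒distinct : ∀ {n} {xs : Vec A n} → Uniqueᵛ xs →
                     ∀ i j → i ≢ j → Vec.lookup xs i ≢ Vec.lookup xs j
  uniqueᵛ⇒distinct u i j i≢j = i≢j ∘ lookup-injective u i j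

  distinct⇒uniqueᵛ : ∀ {n} {xs : Vec A n} → (∀ i j → i ≢ j → Vec.lookup xs i ≢ Vec.lookup xs j) →
                     Uniqueᵛ xs
  distinct⇒uniqueᵛ {xs = []}     _ = []
  distinct⇒uniqueᵛ {xs = x ∷ xs} d =
    VecAll.lookup⁻ (λ j → d zero (suc j) λ ()) ∷
    distinct⇒uniqueᵛ (λ i j i≢j → d (suc i) (suc j) (i≢j ∘ suc-injective))

  uniqueᵛ⇒unique-toList : ∀ {n} {xs : Vec A n} → Uniqueᵛ xs → Unique (toList xs)
  uniqueᵛ⇒unique-toList []       = []
  uniqueᵛ⇒unique-toList (px ∷ u) = VecAll.toList⁺ px ∷ uniqueᵛ⇒unique-toList u

  swap₀₁ : ∀ {n} → Vec A (2 + n) → Vec A (2 + n)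
  swap₀₁ (x ∷ y ∷ xs) = y ∷ x ∷ xs

  swap₀₁-≢ : ∀ {n} {xs : Vec A (2 + n)} → Vec.lookup xs zero ≢ Vec.lookup xs (suc zero) → swap₀₁ xs ≢ xs
  swap₀₁-≢ {xs = _ ∷ _ ∷ _} x≢y e = x≢y (sym (cong Vec.head e))

  ∈-swap₀₁ : ∀ {n} {xs : Vec A (2 + n)} {z} → z ∈ toList (swap₀₁ xs) → z ∈ toList xs
  ∈-swap₀₁ {xs = _ ∷ _ ∷ _} (here z≡y)          = there (here z≡y)
  ∈-swap₀₁ {xs = _ ∷ _ ∷ _} (there (here z≡x))  = here z≡x
  ∈-swap₀₁ {xs = _ ∷ _ ∷ _} (there (there z∈))  = there (there z∈)

  uniqueᵛ-swap₀₁ : ∀ {n} {xs : Vec A (2 + n)} → Uniqueᵛ xs → Uniqueᵛ (swap₀₁ xs)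
  uniqueᵛ-swap₀₁ {xs = _ ∷ _ ∷ _} ((x≢y ∷ x∉) ∷ y∉ ∷ u) = (≢-sym x≢y ∷ y∉) ∷ x∉ ∷ u

module _ {A : Set} (w : A → ℕ) where

  subsetSums : ℕ → List A → List ℕ
  subsetSums zero    _        = 0 ∷ []
  subsetSums (suc k) []       = []
  subsetSums (suc k) (x ∷ xs) = map (w x +_) (subsetSums k xs) ++ subsetSums (suc k) xs

  subsetSums-∷ : ∀ {s} k x xs → s ∈ subsetSums k xs → s ∈ subsetSums k (x ∷ xs)
  subsetSums-∷ zero    x xs s∈ = s∈
  subsetSums-∷ (suc k) x xs s∈ = ∈-++⁺ʳ _ s∈

  module _ (_≟A_ : DecidableEquality A) where
    open import Data.List.Membership.DecPropositional _≟A_ using (_∈?_)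

    sum-∈-subsetSums : ∀ xs {ys} → Unique ys → ys ⊆ xs → sum (map w ys) ∈ subsetSums (length ys) xs
    sum-∈-subsetSums []       {[]}    _ _     = here refl
    sum-∈-subsetSums []       {_ ∷ _} _ ys⊆[] with () ← ys⊆[] (here refl)
    sum-∈-subsetSums (x ∷ xs) {ys}    u ys⊆ with x ∈? ys
    ... | no x∉ys = subsetSums-∷ (length ys) x xs
          (sum-∈-subsetSums xs u (λ y∈ys → ∈-∷⁻ (ys⊆ y∈ys) (λ { refl → x∉ys y∈ys })))
    ... | yes x∈ys with us , ws , refl ← ∈-∃++ x∈ys =
      subst₂ (λ s k → s ∈ subsetSums k (x ∷ xs))
        (sum-↭ (↭.map⁺ w (↭-sym x∷rest))) (sym (↭.↭-length x∷rest))
        (∈-++⁺ˡ (∈-map⁺ (w x +_) (sum-∈-subsetSums xs (AllPairs.tail unique-x∷rest) rest⊆xs)))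
      where
      x∷rest : us ++ x ∷ ws ↭ x ∷ us ++ ws
      x∷rest = ↭.shift x us ws
      unique-x∷rest : Unique (x ∷ us ++ ws)
      unique-x∷rest = Unique-resp-↭ (setoid A) (↭⇒↭ₛ x∷rest) u
      rest⊆xs : us ++ ws ⊆ xs
      rest⊆xs y∈rest = ∈-∷⁻ (ys⊆ (↭.∈-resp-↭ (↭-sym x∷rest) (there y∈rest)))
                            (≢-sym (All.lookup (AllPairs.head unique-x∷rest) y∈rest))

-- Super-simplicity

4≰2 : ¬ 4 ≤ 2
4≰2 (s≤s (s≤s ()))

module _ {v : ℕ} where
  open import Data.List.Membership.DecPropositional (_≟ᶠ_ {v}) using (_∈?_)

  common-⊇ : (b c : Block v) → toList b ⊆ toList c → common b c ≡ 4
  common-⊇ (_ ∷ _ ∷ _ ∷ _ ∷ []) c b⊆c = cong length (filter-all (_∈? toList c) (All.tabulate b⊆c))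

  common≤2⇒≢ : ∀ {b c : Block v} → common b c ≤ 2 → b ≢ c
  common≤2⇒≢ {b} common≤2 refl = contradiction (subst (_≤ 2) (common-⊇ b b (⊆-reflexive refl)) common≤2) 4≰2

  -- Soundness holds for any weight; powers of two make the sums of distinct triples distinct.
  pointWeight : Fin v → ℕ
  pointWeight x = 2 ^ toℕ x

  tripleWeights : Block v → List ℕ
  tripleWeights b = subsetSums pointWeight 3 (toList b)

  common>2⇒sharedTripleWeight : ∀ (b c : Block v) → Uniqueᵛ b → 2 < common b c →
                                ∃[ κ ] (κ ∈ tripleWeights b × κ ∈ tripleWeights c)
  common>2⇒sharedTripleWeight b c u 2<common = _ , inTripleWeights b t⊆b , inTripleWeights c t⊆c
    where
    shared = filter (_∈? toList c) (toList b)
    t = take 3 shared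
    t⊆b : t ⊆ toList b
    t⊆b = All.lookup (All.take⁺ 3 (All.filter⁺ (_∈? toList c) (All.tabulate (⊆-reflexive refl))))
    t⊆c : t ⊆ toList c
    t⊆c = All.lookup (All.take⁺ 3 (All.all-filter (_∈? toList c) (toList b)))
    inTripleWeights : ∀ d → t ⊆ toList d → sum (map pointWeight t) ∈ tripleWeights d
    inTripleWeights d t⊆d =
      subst (λ k → sum (map pointWeight t) ∈ subsetSums pointWeight k (toList d))
        (trans (length-take 3 shared) (m≤n⇒m⊓n≡m 2<common))
        (sum-∈-subsetSums pointWeight _≟ᶠ_ (toList d)
          (Unique.take⁺ 3 (Unique.filter⁺ (_∈? toList c) (uniqueᵛ⇒unique-toList u))) t⊆d)

  unique-tripleWeights⇒superSimple : ∀ B → All Uniqueᵛ B → Unique (concatMap tripleWeights B) → SuperSimple B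
  unique-tripleWeights⇒superSimple B uB u i j i≢j with common (lookup B i) (lookup B j) ≤? 2
  ... | yes ≤2 = ≤2
  ... | no ≰2 with κ , κ∈i , κ∈j ← common>2⇒sharedTripleWeight _ _ (All-lookup⁺ uB i) (≰⇒> ≰2) =
    contradiction κ∈j (unique-concatMap-disjoint tripleWeights B u i j i≢j κ∈i)

-- Swap trades

module SwapTrades {v : ℕ} where

  IsSwapPair : Block v × Block v → Set
  IsSwapPair (b , c) = Vec.lookup b zero ≡ Vec.lookup c (suc zero) × Vec.lookup b (suc zero) ≡ Vec.lookup c zero

  pairsOf : List (Block v) → List (Fin v × Fin v)
  pairsOf = concatMap orderedPairs

  _≟ₚ_ : DecidableEquality (Fin v × Fin v)
  _≟ₚ_ = ×-≡-dec _≟ᶠ_ _≟ᶠ_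

  -- Only (x,y) and (y,x) change blocks; the other pairs of each block are merely reordered.
  swapPair-pairs↭ : ∀ {b c} → IsSwapPair (b , c) →
                    orderedPairs (swap₀₁ b) ++ orderedPairs (swap₀₁ c) ↭ orderedPairs b ++ orderedPairs c
  swapPair-pairs↭ {x ∷ y ∷ a ∷ d ∷ []} {_ ∷ _ ∷ e ∷ f ∷ []} (refl , refl) =
    ↭-trans (prep (y , x) (↭.++⁺ (↭.shifts yb xb {(a , d) ∷ []}) (prep (x , y) (↭.shifts xc yc {(e , f) ∷ []}))))
            (↭-exchange (y , x) (x , y) (xb ++ yb ++ (a , d) ∷ []) (yc ++ xc ++ (e , f) ∷ []))
    where
    xb = (x , a) ∷ (x , d) ∷ []
    yb = (y , a) ∷ (y , d) ∷ []
    xc = (x , e) ∷ (x , f) ∷ []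
    yc = (y , e) ∷ (y , f) ∷ []

  pairsOf-replace : ∀ (L R : List (Block v)) {b c b′ c′ : Block v} →
                    orderedPairs b′ ++ orderedPairs c′ ↭ orderedPairs b ++ orderedPairs c →
                    pairsOf (L ++ b′ ∷ c′ ∷ R) ↭ pairsOf (L ++ b ∷ c ∷ R)
  pairsOf-replace L R {b} {c} {b′} {c′} p =
    subst₂ _↭_ (sym (concatMap-++ orderedPairs L _)) (sym (concatMap-++ orderedPairs L _))
      (↭.++⁺ˡ (pairsOf L) (subst₂ _↭_ (++-assoc (orderedPairs b′) (orderedPairs c′) (pairsOf R))
                                      (++-assoc (orderedPairs b) (orderedPairs c) (pairsOf R))
                                      (↭.++⁺ʳ (pairsOf R) p)))

  distinct-swap₀₁ : ∀ {b : Block v} → DistinctBlock b → DistinctBlock (swap₀₁ b)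
  distinct-swap₀₁ {b} db = uniqueᵛ⇒distinct (uniqueᵛ-swap₀₁ {xs = b} (distinct⇒uniqueᵛ db))

  isDD-swapPair : ∀ (L R : List (Block v)) {b c : Block v} → IsSwapPair (b , c) →
                  IsDD v (L ++ b ∷ c ∷ R) → IsDD v (L ++ swap₀₁ b ∷ swap₀₁ c ∷ R)
  isDD-swapPair L R {b} {c} sw (distinct , covered) = All-lookup⁺ distinct′ , covered′
    where
    swapDistinct : ∀ {b c : Block v} →
                   All DistinctBlock (b ∷ c ∷ R) → All DistinctBlock (swap₀₁ b ∷ swap₀₁ c ∷ R)
    swapDistinct {b} {c} (db ∷ dc ∷ dR) = distinct-swap₀₁ {b} db ∷ distinct-swap₀₁ {c} dc ∷ dR
    distinct′ = All.++⁺ (All.++⁻ˡ L (All-lookup⁻ distinct)) (swapDistinct (All.++⁻ʳ L (All-lookup⁻ distinct)))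
    covered′ : ∀ x y → x ≢ y → pairCount (L ++ swap₀₁ b ∷ swap₀₁ c ∷ R) x y ≡ 2
    covered′ x y x≢y =
      trans (count-↭ (_≟ₚ (x , y)) (pairsOf-replace L R (swapPair-pairs↭ {b} {c} sw))) (covered x y x≢y)

  mult-replace : ∀ (L R : List (Block v)) {b c b′ c′ β : Block v} → b ≢ β → c ≢ β →
                 mult β (L ++ b ∷ c ∷ R) ≤ mult β (L ++ b′ ∷ c′ ∷ R)
  mult-replace L R {b} {c} {b′} {c′} {β} b≢β c≢β = begin
    mult β (L ++ b ∷ c ∷ R)          ≡⟨ count-++ (_≟ᵇ β) L (b ∷ c ∷ R) ⟩
    mult β L + mult β (b ∷ c ∷ R)    ≡⟨ cong (mult β L +_) (trans (count-reject (_≟ᵇ β) b≢β)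
                                                                 (count-reject (_≟ᵇ β) c≢β)) ⟩
    mult β L + mult β R              ≤⟨ +-monoʳ-≤ (mult β L) (≤-trans (count-∷-≤ (_≟ᵇ β) c′ R)
                                                                       (count-∷-≤ (_≟ᵇ β) b′ (c′ ∷ R))) ⟩
    mult β L + mult β (b′ ∷ c′ ∷ R)  ≡⟨ count-++ (_≟ᵇ β) L (b′ ∷ c′ ∷ R) ⟨
    mult β (L ++ b′ ∷ c′ ∷ R)        ∎
    where open ≤-Reasoning

  ⊆ₘ-replace : ∀ (L R : List (Block v)) {b c b′ c′ : Block v} {S : List (Block v)} →
               mult b S ≡ 0 → mult c S ≡ 0 → S ⊆ₘ (L ++ b ∷ c ∷ R) → S ⊆ₘ (L ++ b′ ∷ c′ ∷ R)
  ⊆ₘ-replace L R {b} {c} {b′} {c′} {S} b∉S c∉S S⊆B β with mult β S ≟ 0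
  ... | yes β∉S = subst (_≤ mult β (L ++ b′ ∷ c′ ∷ R)) (sym β∉S) z≤n
  ... | no β∈S  = ≤-trans (S⊆B β)
                    (mult-replace L R {b} {c} {b′} {c′} {β} (λ { refl → β∈S b∉S }) (λ { refl → β∈S c∉S }))

  swapPair-≉ₘ : ∀ (L R : List (Block v)) {b c : Block v} → DistinctBlock b → common b c ≤ 2 →
                ¬ (L ++ swap₀₁ b ∷ swap₀₁ c ∷ R) ≈ₘ (L ++ b ∷ c ∷ R)
  swapPair-≉ₘ L R {b} {c} db common≤2 same = <-irrefl (same b) (begin-strict
    mult b (L ++ swap₀₁ b ∷ swap₀₁ c ∷ R)        ≡⟨ count-++ (_≟ᵇ b) L _ ⟩
    mult b L + mult b (swap₀₁ b ∷ swap₀₁ c ∷ R)  ≡⟨ cong (mult b L +_) (trans (count-reject (_≟ᵇ b) swap-b≢b)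
                                                                              (count-reject (_≟ᵇ b) swap-c≢b)) ⟩
    mult b L + mult b R                          <⟨ +-monoʳ-< (mult b L) (s≤s (count-∷-≤ (_≟ᵇ b) c R)) ⟩
    mult b L + suc (mult b (c ∷ R))              ≡⟨ cong (mult b L +_) (count-accept (_≟ᵇ b) refl) ⟨
    mult b L + mult b (b ∷ c ∷ R)                ≡⟨ count-++ (_≟ᵇ b) L _ ⟨
    mult b (L ++ b ∷ c ∷ R)                      ∎)
    where
    open ≤-Reasoning
    swap-b≢b : swap₀₁ b ≢ b
    swap-b≢b = swap₀₁-≢ {xs = b} (db zero (suc zero) λ ())
    swap-c≢b : swap₀₁ c ≢ b
    swap-c≢b refl = contradiction (subst (_≤ 2) (common-⊇ (swap₀₁ c) c (∈-swap₀₁ {xs = c})) common≤2) 4≰2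

  untouchedSwapPair⇒¬defining : ∀ (L R : List (Block v)) {b c : Block v} {S} →
    IsDD v (L ++ b ∷ c ∷ R) → IsSwapPair (b , c) → common b c ≤ 2 → mult b S ≡ 0 → mult c S ≡ 0 →
    ¬ IsDefiningSet v (L ++ b ∷ c ∷ R) S
  untouchedSwapPair⇒¬defining L R {b} {c} {S} dd sw common≤2 b∉S c∉S (S⊆B , determines) =
    swapPair-≉ₘ L R db common≤2
      (determines (L ++ swap₀₁ b ∷ swap₀₁ c ∷ R) (isDD-swapPair L R sw dd)
                  (⊆ₘ-replace L R {S = S} b∉S c∉S S⊆B))
    where
    db : DistinctBlock b
    db = All.lookup (All-lookup⁻ {P = DistinctBlock} (proj₁ dd)) (∈-++⁺ʳ L (here refl))

  Σmult : List (Block v) → List (Block v) → ℕ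
  Σmult U S = sum (map (λ u → mult u S) U)

  Σmult-[] : ∀ U → Σmult U [] ≡ 0
  Σmult-[] []      = refl
  Σmult-[] (_ ∷ U) = Σmult-[] U

  Σmult-∷ : ∀ U s S → Σmult U (s ∷ S) ≡ count (s ≟ᵇ_) U + Σmult U S
  Σmult-∷ []      s S = refl
  Σmult-∷ (u ∷ U) s S with s ≟ᵇ u
  ... | yes _ = cong suc (trans (cong (mult u S +_) (Σmult-∷ U s S))
                                (x∙yz≈y∙xz (mult u S) (count (s ≟ᵇ_) U) (Σmult U S)))
  ... | no _  = trans (cong (mult u S +_) (Σmult-∷ U s S))
                      (x∙yz≈y∙xz (mult u S) (count (s ≟ᵇ_) U) (Σmult U S))

  -- Each element of S is counted by at most one of the distinct blocks of U.
  Σmult-≤-length : ∀ {U} → Unique U → ∀ S → Σmult U S ≤ length S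
  Σmult-≤-length {U} u []      = ≤-reflexive (Σmult-[] U)
  Σmult-≤-length {U} u (s ∷ S) = subst (_≤ suc (length S)) (sym (Σmult-∷ U s S))
                                   (+-mono-≤ (count-unique-≤1 _≟ᵇ_ u) (Σmult-≤-length u S))

  Σmult-flatten : ∀ (P : List (Block v × Block v)) S →
                  Σmult (flatten P) S ≡ sum (map (λ (b , c) → mult b S + mult c S) P)
  Σmult-flatten []            S = refl
  Σmult-flatten ((b , c) ∷ P) S =
    trans (cong (λ n → mult b S + (mult c S + n)) (Σmult-flatten P S)) (sym (+-assoc (mult b S) _ _))

  untouchedPair : ∀ (P : List (Block v × Block v)) {S} → Unique (flatten P) → length S < length P →
                  Any (λ (b , c) → mult b S ≡ 0 × mult c S ≡ 0) P
  untouchedPair P {S} u |S|<|P| =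
    Any.map (λ {(b , c)} none → m+n≡0⇒m≡0 (mult b S) none , m+n≡0⇒n≡0 (mult b S) none)
      (pigeonhole (λ (b , c) → mult b S + mult c S) P
        (≤-<-trans (≤-reflexive (sym (Σmult-flatten P S))) (≤-<-trans (Σmult-≤-length u S) |S|<|P|)))

  untouchedSwapPair∈⇒¬defining : ∀ (P : List (Block v × Block v)) {b c S} →
    IsDD v (flatten P) → All IsSwapPair P → All (λ (b , c) → common b c ≤ 2) P →
    (b , c) ∈ P → mult b S ≡ 0 → mult c S ≡ 0 → ¬ IsDefiningSet v (flatten P) S
  untouchedSwapPair∈⇒¬defining P {b} {c} {S} dd swaps commons bc∈P b∉S c∉S
    with P₁ , P₂ , refl ← ∈-∃++ bc∈P =
    untouchedSwapPair⇒¬defining (flatten P₁) (flatten P₂) {b} {c} {S} (subst (IsDD v) split dd)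
      (All.lookup swaps bc∈P) (All.lookup commons bc∈P) b∉S c∉S ∘ subst (λ B → IsDefiningSet v B S) split
    where
    split = flatten-++ P₁ ((b , c) ∷ P₂)

  pairs-common≤2 : ∀ (P : List (Block v × Block v)) →
                   AllPairs (λ b c → common b c ≤ 2) (flatten P) → All (λ (b , c) → common b c ≤ 2) P
  pairs-common≤2 []            _                     = []
  pairs-common≤2 ((b , c) ∷ P) ((bc ∷ _) ∷ _ ∷ rest) = bc ∷ pairs-common≤2 P rest

  swapPairs⇒ratio≥½ : ∀ (P : List (Block v × Block v)) → IsDD v (flatten P) → SuperSimple (flatten P) →
                      All IsSwapPair P → DefiningRatioAtLeastHalf v (flatten P)
  swapPairs⇒ratio≥½ P dd ss swaps S defining with length (flatten P) ≤? 2 * length S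
  ... | yes ok    = ok
  ... | no tooFew =
    let (b , c) , bc∈P , b∉S , c∉S = find (untouchedPair P {S} unique |S|<|P|)
    in  contradiction defining
          (untouchedSwapPair∈⇒¬defining P {b} {c} {S} dd swaps (pairs-common≤2 P pairwise) bc∈P b∉S c∉S)
    where
    pairwise : AllPairs (λ b c → common b c ≤ 2) (flatten P)
    pairwise = AllPairs-lookup⁻ ss
    unique : Unique (flatten P)
    unique = AllPairs.map common≤2⇒≢ pairwise
    |S|<|P| : length S < length P
    |S|<|P| = *-cancelˡ-< 2 (length S) (length P) (subst (2 * length S <_) (length-flatten P) (≰⇒> tooFew))

-- Certified cyclic development

tradeAt : ℕ → Vec ℕ 6 → Vec ℕ 4 × Vec ℕ 4
tradeAt t (x ∷ y ∷ a ∷ d ∷ e ∷ f ∷ []) =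
  (x + t ∷ y + t ∷ a + t ∷ d + t ∷ []) , (y + t ∷ x + t ∷ e + t ∷ f + t ∷ [])

develop : List (Vec ℕ 6 × ℕ) → List (Vec ℕ 4 × Vec ℕ 4)
develop = concatMap λ (base , n) → map (λ t → tradeAt t base) (upTo n)

module Certificate (v : ℕ) .{{_ : NonZero v}} where
  open SwapTrades {v}

  toBlock : Vec ℕ 4 → Block v
  toBlock = Vec.map (_mod v)

  toBlockPair : Vec ℕ 4 × Vec ℕ 4 → Block v × Block v
  toBlockPair (r , s) = toBlock r , toBlock s

  toℕ-mod : ∀ a → toℕ (a mod v) ≡ a % v
  toℕ-mod a = toℕ-fromℕ< (m%n<n a v)

  isSwapPair-tradeAt : ∀ t base → IsSwapPair (toBlockPair (tradeAt t base))
  isSwapPair-tradeAt t (_ ∷ _ ∷ _ ∷ _ ∷ _ ∷ _ ∷ []) = refl , refl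

  isSwapPair-develop : ∀ bases → All IsSwapPair (map toBlockPair (develop bases))
  isSwapPair-develop bases = All.map⁺ (All.concat⁺ (All.map⁺ (All.universal
    (λ (base , n) → All.map⁺ (All.universal (λ t → isSwapPair-tradeAt t base) (upTo n))) bases)))

  pairCode : ℕ → ℕ → ℕ
  pairCode x y = x * v + y

  pairCode-rem : ∀ x {y} → y < v → pairCode x y % v ≡ y
  pairCode-rem x {y} y<v = trans (cong (_% v) (+-comm (x * v) y)) (trans ([m+kn]%n≡m%n y x v) (m<n⇒m%n≡m y<v))

  pairCode-quot : ∀ x {y} → y < v → pairCode x y / v ≡ x
  pairCode-quot x {y} y<v = begin
    (x * v + y) / v    ≡⟨ +-distrib-/ (x * v) y remainders<v ⟩
    x * v / v + y / v  ≡⟨ cong₂ _+_ (m*n/n≡m x v) (m<n⇒m/n≡0 y<v) ⟩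
    x + 0              ≡⟨ +-identityʳ x ⟩
    x                  ∎
    where
    open ≡-Reasoning
    remainders<v : (x * v) % v + y % v < v
    remainders<v = subst₂ (λ r s → r + s < v) (sym (m*n%n≡0 x v)) (sym (m<n⇒m%n≡m y<v)) y<v

  pairCode<v² : ∀ {x y} → x < v → y < v → pairCode x y < v * v
  pairCode<v² {x} {y} x<v y<v = begin-strict
    x * v + y  <⟨ +-monoʳ-< (x * v) y<v ⟩
    x * v + v  ≡⟨ +-comm (x * v) v ⟩
    suc x * v  ≤⟨ *-monoˡ-≤ v x<v ⟩
    v * v      ∎
    where open ≤-Reasoning

  pairCodeᶠ : Fin v × Fin v → ℕ
  pairCodeᶠ (x , y) = pairCode (toℕ x) (toℕ y)

  pairCodeᶠ-injective : ∀ {p q} → pairCodeᶠ p ≡ pairCodeᶠ q → p ≡ q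
  pairCodeᶠ-injective {x , y} {x′ , y′} e = cong₂ _,_
    (toℕ-injective (trans (sym (pairCode-quot (toℕ x) (toℕ<n y)))
                          (trans (cong (_/ v) e) (pairCode-quot (toℕ x′) (toℕ<n y′)))))
    (toℕ-injective (trans (sym (pairCode-rem (toℕ x) (toℕ<n y)))
                          (trans (cong (_% v) e) (pairCode-rem (toℕ x′) (toℕ<n y′)))))

  requiredCount : ℕ → ℕ → ℕ
  requiredCount x y = if x ≡ᵇ y then 0 else 2

  requiredCount-diag : ∀ n → requiredCount n n ≡ 0
  requiredCount-diag zero    = refl
  requiredCount-diag (suc n) = requiredCount-diag n

  requiredCount-≢ : ∀ {x y : Fin v} → x ≢ y → requiredCount (toℕ x) (toℕ y) ≡ 2
  requiredCount-≢ {x} {y} x≢y with toℕ x ≡ᵇ toℕ y in eq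
  ... | false = refl
  ... | true  = contradiction (toℕ-injective (≡ᵇ⇒≡ (toℕ x) (toℕ y) (subst T (sym eq) tt))) x≢y

  expectedPairCodes : List ℕ
  expectedPairCodes = downFromWith (λ i → requiredCount (i / v) (i % v)) (v * v)

  count-expectedPairCodes : ∀ x y → count (_≟ pairCodeᶠ (x , y)) expectedPairCodes ≡ requiredCount (toℕ x) (toℕ y)
  count-expectedPairCodes x y =
    trans (count-downFromWith _ (pairCode<v² (toℕ<n x) (toℕ<n y)))
          (cong₂ requiredCount (pairCode-quot (toℕ x) (toℕ<n y)) (pairCode-rem (toℕ x) (toℕ<n y)))

  pairCodesℕ : Vec ℕ 4 → List ℕ
  pairCodesℕ (a ∷ b ∷ c ∷ d ∷ []) =
    pairCode (a % v) (b % v) ∷ pairCode (a % v) (c % v) ∷ pairCode (a % v) (d % v) ∷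
    pairCode (b % v) (c % v) ∷ pairCode (b % v) (d % v) ∷ pairCode (c % v) (d % v) ∷ []

  pairCodes-toBlock : ∀ r → map pairCodeᶠ (orderedPairs (toBlock r)) ≡ pairCodesℕ r
  pairCodes-toBlock (a ∷ b ∷ c ∷ d ∷ []) rewrite toℕ-mod a | toℕ-mod b | toℕ-mod c | toℕ-mod d = refl

  pairCodes-toBlocks : ∀ R → map pairCodeᶠ (pairsOf (map toBlock R)) ≡ concatMap pairCodesℕ R
  pairCodes-toBlocks []      = refl
  pairCodes-toBlocks (r ∷ R) = trans (map-++ pairCodeᶠ (orderedPairs (toBlock r)) _)
                                     (cong₂ _++_ (pairCodes-toBlock r) (pairCodes-toBlocks R))

  PairCertificate : List (Vec ℕ 4) → Set
  PairCertificate R = sort (concatMap pairCodesℕ R) ≡ expectedPairCodes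

  pairCount-certified : ∀ R → PairCertificate R →
                        ∀ x y → pairCount (map toBlock R) x y ≡ requiredCount (toℕ x) (toℕ y)
  pairCount-certified R cert x y = begin
    pairCount (map toBlock R) x y           ≡⟨ count-map _≟ₚ_ pairCodeᶠ pairCodeᶠ-injective (x , y) pairs ⟩
    count (_≟ c) (map pairCodeᶠ pairs)      ≡⟨ cong (count (_≟ c)) (pairCodes-toBlocks R) ⟩
    count (_≟ c) codes                      ≡⟨ count-↭ (_≟ c) (sort-↭ codes) ⟨
    count (_≟ c) (sort codes)               ≡⟨ cong (count (_≟ c)) cert ⟩
    count (_≟ c) expectedPairCodes          ≡⟨ count-expectedPairCodes x y ⟩
    requiredCount (toℕ x) (toℕ y)           ∎
    where
    open ≡-Reasoning
    c = pairCodeᶠ (x , y)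
    pairs = pairsOf (map toBlock R)
    codes = concatMap pairCodesℕ R

  noLoops⇒uniqueᵛ : (b : Block v) → (∀ x → (x , x) ∉ orderedPairs b) → Uniqueᵛ b
  noLoops⇒uniqueᵛ b@(_ ∷ _ ∷ _ ∷ _ ∷ []) noLoop =
      (≢ (here refl) ∷ ≢ (there (here refl)) ∷ ≢ (there (there (here refl))) ∷ [])
    ∷ (≢ (there (there (there (here refl)))) ∷ ≢ (there (there (there (there (here refl))))) ∷ [])
    ∷ (≢ (there (there (there (there (there (here refl)))))) ∷ [])
    ∷ [] ∷ []
    where
    ≢ : ∀ {x y} → (x , y) ∈ orderedPairs b → x ≢ y
    ≢ p refl = noLoop _ p

  ∈-pairsOf : ∀ {b B p} → b ∈ B → p ∈ orderedPairs b → p ∈ pairsOf B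
  ∈-pairsOf b∈B p∈b = ∈-concatMap⁺ orderedPairs (Any.map (λ { refl → p∈b }) b∈B)

  isDD-certified : ∀ R → PairCertificate R → IsDD v (map toBlock R)
  isDD-certified R cert = All-lookup⁺ (All.tabulate distinct) , covered
    where
    counts = pairCount-certified R cert
    covered : ∀ x y → x ≢ y → pairCount (map toBlock R) x y ≡ 2
    covered x y x≢y = trans (counts x y) (requiredCount-≢ x≢y)
    distinct : ∀ {b} → b ∈ map toBlock R → DistinctBlock b
    distinct {b} b∈B = uniqueᵛ⇒distinct (noLoops⇒uniqueᵛ b λ x xx∈b →
      count≡0⇒∉ (_≟ₚ (x , x)) (trans (counts x x) (requiredCount-diag (toℕ x))) (∈-pairsOf b∈B xx∈b) refl)

  tripleWeightsℕ : Vec ℕ 4 → List ℕ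
  tripleWeightsℕ r = subsetSums (λ a → 2 ^ (a % v)) 3 (toList r)

  tripleWeights-toBlock : ∀ r → tripleWeights (toBlock r) ≡ tripleWeightsℕ r
  tripleWeights-toBlock (a ∷ b ∷ c ∷ d ∷ []) rewrite toℕ-mod a | toℕ-mod b | toℕ-mod c | toℕ-mod d = refl

  TripleCertificate : List (Vec ℕ 4) → Set
  TripleCertificate R = Linked _>_ (sort (concatMap tripleWeightsℕ R))

  superSimple-certified : ∀ R → IsDD v (map toBlock R) → TripleCertificate R → SuperSimple (map toBlock R)
  superSimple-certified R (distinct , _) cert =
    unique-tripleWeights⇒superSimple (map toBlock R) (All.map distinct⇒uniqueᵛ (All-lookup⁻ distinct))
      (subst Unique (sym weights≡) (Unique-resp-↭ (setoid ℕ) (↭⇒↭ₛ (sort-↭ (concatMap tripleWeightsℕ R)))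
        (AllPairs.map >⇒≢ (Linked⇒AllPairs (λ x>y y>z → <-trans y>z x>y) cert))))
    where
    weights≡ : concatMap tripleWeights (map toBlock R) ≡ concatMap tripleWeightsℕ R
    weights≡ = trans (concatMap-map tripleWeights toBlock R) (concatMap-cong tripleWeights-toBlock R)

  certificate? : ∀ R → Dec (PairCertificate R × TripleCertificate R)
  certificate? R = List-≡-dec _≟_ _ _ ×-dec linked? _>?_ _

  design : ∀ bases → True (certificate? (flatten (develop bases))) →
           Σ[ B ∈ List (Block v) ] (IsDD v B × SuperSimple B × DefiningRatioAtLeastHalf v B)
  design bases certified = B , dd , ss ,
    subst (DefiningRatioAtLeastHalf v) P≡B
      (swapPairs⇒ratio≥½ P (subst (IsDD v) (sym P≡B) dd) (subst SuperSimple (sym P≡B) ss) (isSwapPair-develop bases))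
    where
    R = flatten (develop bases)
    B = map toBlock R
    P = map toBlockPair (develop bases)
    P≡B : flatten P ≡ B
    P≡B = flatten-map toBlock (develop bases)
    dd = isDD-certified R (proj₁ (toWitness certified))
    ss = superSimple-certified R dd (proj₂ (toWitness certified))

-- (x ∷ y ∷ a ∷ d ∷ e ∷ f ∷ [] , n) stands for the trades {(x,y,a,d), (y,x,e,f)} + t, 0 ≤ t < n, modulo v.
baseTrades55 : List (Vec ℕ 6 × ℕ)
baseTrades55 =
    (0 ∷ 41 ∷ 14 ∷ 50 ∷ 84 ∷ 49 ∷ [] , 55)
  ∷ (0 ∷ 18 ∷ 16 ∷ 23 ∷ 43 ∷ 58 ∷ [] , 55)
  ∷ (0 ∷ 21 ∷ 4 ∷ 30 ∷ 36 ∷ 65 ∷ [] , 55)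
  ∷ (0 ∷ 30 ∷ 3 ∷ 13 ∷ 31 ∷ 54 ∷ [] , 55)
  ∷ (0 ∷ 37 ∷ 17 ∷ 49 ∷ 71 ∷ 88 ∷ [] , 55)
  ∷ (0 ∷ 54 ∷ 45 ∷ 47 ∷ 99 ∷ 66 ∷ [] , 55)
  ∷ (0 ∷ 5 ∷ 47 ∷ 31 ∷ 27 ∷ 24 ∷ [] , 55)
  ∷ (0 ∷ 13 ∷ 33 ∷ 19 ∷ 21 ∷ 53 ∷ [] , 55)
  ∷ (0 ∷ 4 ∷ 6 ∷ 52 ∷ 39 ∷ 11 ∷ [] , 55)
  ∷ []

baseTrades82 : List (Vec ℕ 6 × ℕ)
baseTrades82 =
    (0 ∷ 53 ∷ 77 ∷ 54 ∷ 85 ∷ 131 ∷ [] , 82)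
  ∷ (0 ∷ 51 ∷ 53 ∷ 31 ∷ 69 ∷ 117 ∷ [] , 82)
  ∷ (0 ∷ 4 ∷ 6 ∷ 23 ∷ 21 ∷ 68 ∷ [] , 82)
  ∷ (0 ∷ 21 ∷ 66 ∷ 56 ∷ 65 ∷ 30 ∷ [] , 82)
  ∷ (0 ∷ 3 ∷ 18 ∷ 74 ∷ 55 ∷ 43 ∷ [] , 82)
  ∷ (0 ∷ 11 ∷ 80 ∷ 25 ∷ 16 ∷ 45 ∷ [] , 82)
  ∷ (0 ∷ 20 ∷ 57 ∷ 13 ∷ 96 ∷ 42 ∷ [] , 82)
  ∷ (0 ∷ 12 ∷ 48 ∷ 25 ∷ 22 ∷ 77 ∷ [] , 82)
  ∷ (0 ∷ 76 ∷ 32 ∷ 58 ∷ 125 ∷ 149 ∷ [] , 82)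
  ∷ (0 ∷ 30 ∷ 63 ∷ 42 ∷ 93 ∷ 50 ∷ [] , 82)
  ∷ (0 ∷ 81 ∷ 80 ∷ 72 ∷ 91 ∷ 118 ∷ [] , 82)
  ∷ (0 ∷ 7 ∷ 57 ∷ 15 ∷ 33 ∷ 41 ∷ [] , 82)
  ∷ (0 ∷ 54 ∷ 16 ∷ 39 ∷ 133 ∷ 58 ∷ [] , 82)
  ∷ (0 ∷ 41 ∷ 19 ∷ 5 ∷ 60 ∷ 46 ∷ [] , 41)
  ∷ []

baseTrades85 : List (Vec ℕ 6 × ℕ)
baseTrades85 =
    (0 ∷ 29 ∷ 25 ∷ 82 ∷ 90 ∷ 59 ∷ [] , 85)
  ∷ (0 ∷ 48 ∷ 13 ∷ 4 ∷ 126 ∷ 103 ∷ [] , 85)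
  ∷ (0 ∷ 33 ∷ 80 ∷ 14 ∷ 109 ∷ 72 ∷ [] , 85)
  ∷ (0 ∷ 46 ∷ 1 ∷ 12 ∷ 111 ∷ 64 ∷ [] , 85)
  ∷ (0 ∷ 29 ∷ 12 ∷ 73 ∷ 38 ∷ 69 ∷ [] , 85)
  ∷ (0 ∷ 14 ∷ 50 ∷ 84 ∷ 42 ∷ 59 ∷ [] , 85)
  ∷ (0 ∷ 49 ∷ 9 ∷ 55 ∷ 128 ∷ 117 ∷ [] , 85)
  ∷ (0 ∷ 63 ∷ 35 ∷ 58 ∷ 90 ∷ 106 ∷ [] , 85)
  ∷ (0 ∷ 2 ∷ 30 ∷ 49 ∷ 77 ∷ 15 ∷ [] , 85)
  ∷ (0 ∷ 82 ∷ 17 ∷ 3 ∷ 151 ∷ 159 ∷ [] , 85)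
  ∷ (0 ∷ 10 ∷ 35 ∷ 20 ∷ 34 ∷ 42 ∷ [] , 85)
  ∷ (0 ∷ 78 ∷ 44 ∷ 26 ∷ 157 ∷ 145 ∷ [] , 85)
  ∷ (0 ∷ 84 ∷ 63 ∷ 15 ∷ 137 ∷ 106 ∷ [] , 85)
  ∷ (0 ∷ 81 ∷ 27 ∷ 7 ∷ 83 ∷ 143 ∷ [] , 85)
  ∷ []

baseTrades106 : List (Vec ℕ 6 × ℕ)
baseTrades106 =
    (0 ∷ 33 ∷ 38 ∷ 101 ∷ 112 ∷ 99 ∷ [] , 106)
  ∷ (0 ∷ 69 ∷ 23 ∷ 104 ∷ 113 ∷ 168 ∷ [] , 106)
  ∷ (0 ∷ 26 ∷ 104 ∷ 27 ∷ 46 ∷ 50 ∷ [] , 106)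
  ∷ (0 ∷ 88 ∷ 44 ∷ 54 ∷ 131 ∷ 101 ∷ [] , 106)
  ∷ (0 ∷ 35 ∷ 32 ∷ 72 ∷ 117 ∷ 58 ∷ [] , 106)
  ∷ (0 ∷ 52 ∷ 63 ∷ 97 ∷ 142 ∷ 57 ∷ [] , 106)
  ∷ (0 ∷ 94 ∷ 27 ∷ 84 ∷ 187 ∷ 183 ∷ [] , 106)
  ∷ (0 ∷ 61 ∷ 102 ∷ 10 ∷ 136 ∷ 158 ∷ [] , 106)
  ∷ (0 ∷ 28 ∷ 22 ∷ 86 ∷ 115 ∷ 94 ∷ [] , 106)
  ∷ (0 ∷ 24 ∷ 73 ∷ 75 ∷ 64 ∷ 70 ∷ [] , 106)
  ∷ (0 ∷ 105 ∷ 76 ∷ 29 ∷ 124 ∷ 193 ∷ [] , 106)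
  ∷ (0 ∷ 90 ∷ 31 ∷ 16 ∷ 155 ∷ 110 ∷ [] , 106)
  ∷ (0 ∷ 26 ∷ 25 ∷ 15 ∷ 28 ∷ 43 ∷ [] , 106)
  ∷ (0 ∷ 8 ∷ 42 ∷ 21 ∷ 79 ∷ 56 ∷ [] , 106)
  ∷ (0 ∷ 68 ∷ 3 ∷ 36 ∷ 157 ∷ 154 ∷ [] , 106)
  ∷ (0 ∷ 67 ∷ 70 ∷ 56 ∷ 120 ∷ 74 ∷ [] , 106)
  ∷ (0 ∷ 98 ∷ 83 ∷ 92 ∷ 148 ∷ 165 ∷ [] , 106)
  ∷ (0 ∷ 53 ∷ 65 ∷ 84 ∷ 118 ∷ 137 ∷ [] , 53)
  ∷ []

baseTrades109 : List (Vec ℕ 6 × ℕ)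
baseTrades109 =
    (0 ∷ 34 ∷ 106 ∷ 7 ∷ 76 ∷ 62 ∷ [] , 109)
  ∷ (0 ∷ 31 ∷ 69 ∷ 67 ∷ 59 ∷ 62 ∷ [] , 109)
  ∷ (0 ∷ 79 ∷ 41 ∷ 85 ∷ 154 ∷ 132 ∷ [] , 109)
  ∷ (0 ∷ 82 ∷ 88 ∷ 12 ∷ 143 ∷ 118 ∷ [] , 109)
  ∷ (0 ∷ 29 ∷ 9 ∷ 95 ∷ 105 ∷ 54 ∷ [] , 109)
  ∷ (0 ∷ 99 ∷ 88 ∷ 20 ∷ 173 ∷ 199 ∷ [] , 109)
  ∷ (0 ∷ 5 ∷ 44 ∷ 99 ∷ 21 ∷ 102 ∷ [] , 109)
  ∷ (0 ∷ 5 ∷ 73 ∷ 51 ∷ 45 ∷ 63 ∷ [] , 109)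
  ∷ (0 ∷ 13 ∷ 12 ∷ 32 ∷ 37 ∷ 53 ∷ [] , 109)
  ∷ (0 ∷ 42 ∷ 25 ∷ 89 ∷ 56 ∷ 91 ∷ [] , 109)
  ∷ (0 ∷ 80 ∷ 50 ∷ 14 ∷ 172 ∷ 128 ∷ [] , 109)
  ∷ (0 ∷ 61 ∷ 84 ∷ 18 ∷ 131 ∷ 93 ∷ [] , 109)
  ∷ (0 ∷ 1 ∷ 3 ∷ 86 ∷ 2 ∷ 103 ∷ [] , 109)
  ∷ (0 ∷ 105 ∷ 97 ∷ 47 ∷ 113 ∷ 120 ∷ [] , 109)
  ∷ (0 ∷ 35 ∷ 68 ∷ 52 ∷ 72 ∷ 57 ∷ [] , 109)
  ∷ (0 ∷ 60 ∷ 11 ∷ 8 ∷ 130 ∷ 98 ∷ [] , 109)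
  ∷ (0 ∷ 54 ∷ 100 ∷ 81 ∷ 161 ∷ 69 ∷ [] , 109)
  ∷ (0 ∷ 26 ∷ 13 ∷ 91 ∷ 103 ∷ 50 ∷ [] , 109)
  ∷ []

baseTrades118 : List (Vec ℕ 6 × ℕ)
baseTrades118 =
    (0 ∷ 98 ∷ 4 ∷ 31 ∷ 209 ∷ 179 ∷ [] , 118)
  ∷ (0 ∷ 77 ∷ 36 ∷ 69 ∷ 191 ∷ 144 ∷ [] , 118)
  ∷ (0 ∷ 108 ∷ 53 ∷ 36 ∷ 109 ∷ 199 ∷ [] , 118)
  ∷ (0 ∷ 103 ∷ 26 ∷ 102 ∷ 197 ∷ 137 ∷ [] , 118)
  ∷ (0 ∷ 74 ∷ 86 ∷ 97 ∷ 162 ∷ 146 ∷ [] , 118)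
  ∷ (0 ∷ 107 ∷ 116 ∷ 37 ∷ 173 ∷ 150 ∷ [] , 118)
  ∷ (0 ∷ 61 ∷ 21 ∷ 54 ∷ 100 ∷ 71 ∷ [] , 118)
  ∷ (0 ∷ 78 ∷ 42 ∷ 112 ∷ 132 ∷ 87 ∷ [] , 118)
  ∷ (0 ∷ 89 ∷ 106 ∷ 8 ∷ 202 ∷ 131 ∷ [] , 118)
  ∷ (0 ∷ 23 ∷ 18 ∷ 110 ∷ 83 ∷ 30 ∷ [] , 118)
  ∷ (0 ∷ 53 ∷ 109 ∷ 40 ∷ 137 ∷ 115 ∷ [] , 118)
  ∷ (0 ∷ 80 ∷ 45 ∷ 104 ∷ 166 ∷ 93 ∷ [] , 118)
  ∷ (0 ∷ 96 ∷ 75 ∷ 72 ∷ 123 ∷ 148 ∷ [] , 118)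
  ∷ (0 ∷ 112 ∷ 69 ∷ 25 ∷ 150 ∷ 210 ∷ [] , 118)
  ∷ (0 ∷ 63 ∷ 3 ∷ 1 ∷ 106 ∷ 153 ∷ [] , 118)
  ∷ (0 ∷ 50 ∷ 62 ∷ 79 ∷ 120 ∷ 107 ∷ [] , 118)
  ∷ (0 ∷ 18 ∷ 46 ∷ 4 ∷ 82 ∷ 85 ∷ [] , 118)
  ∷ (0 ∷ 103 ∷ 93 ∷ 99 ∷ 117 ∷ 125 ∷ [] , 118)
  ∷ (0 ∷ 68 ∷ 2 ∷ 51 ∷ 153 ∷ 134 ∷ [] , 118)
  ∷ (0 ∷ 59 ∷ 64 ∷ 80 ∷ 123 ∷ 139 ∷ [] , 59)
  ∷ []

lemma10 : ∀ (v : ℕ) → v ∈ (55 ∷ 82 ∷ 85 ∷ 106 ∷ 109 ∷ 118 ∷ [])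
    → Σ[ B ∈ List (Block v) ] (IsDD v B × SuperSimple B × DefiningRatioAtLeastHalf v B)
lemma10 .55  (here refl)                                         = Certificate.design 55  baseTrades55  _
lemma10 .82  (there (here refl))                                 = Certificate.design 82  baseTrades82  _
lemma10 .85  (there (there (here refl)))                         = Certificate.design 85  baseTrades85  _
lemma10 .106 (there (there (there (here refl))))                 = Certificate.design 106 baseTrades106 _
lemma10 .109 (there (there (there (there (here refl)))))         = Certificate.design 109 baseTrades109 _
lemma10 .118 (there (there (there (there (there (here refl)))))) = Certificate.design 118 baseTrades118 _
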